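{- For all closed terms $P$ and $Q$ over $\Sigma_{CP}(A)$: if $\mathrm{CP}\vdash P=Q$ then $P=_{fr}Q$.
   Context: Fix a finite non-empty set $A$ of atomic propositions. Closed terms over $\Sigma_{CP}(A)$ are built from $T$, $F$ and $a\in A$ by conditional composition $P\triangleleft Q\triangleright R$. CP consists of the axioms (CP1) $x\triangleleft T\triangleright y=x$, (CP2) $x\triangleleft F\triangleright y=y$, (CP3) $T\triangleleft x\triangleright F=x$, (CP4) $x\triangleleft(y\triangleleft z\triangleright u)\triangleright v=(x\triangleleft y\triangleright v)\triangleleft z\triangleright(x\triangleleft u\triangleright v)$, with $\vdash$ derivability in equational logic. A reactive valuation algebra (RVA) is a set $RV$ with elements $T_{RV},F_{RV}$ and for each $a\in A$ functions $y_a:RV\to\{T,F\}$ and $\partial_a:RV\to RV$ with $y_a(T_{RV})=T$, $y_a(F_{RV})=F$, $\partial_a(T_{RV})=T_{RV}$, $\partial_a(F_{RV})=F_{RV}$. For closed $P$ and $H\in RV$ define $P/H\in\{T,F\}$ and $\partial_P(H)\in RV$ by: $T/H=T$, $F/H=F$, $a/H=y_a(H)$, $\partial_T(H)=\partial_F(H)=H$, $\partial_a$ as given; $(P\triangleleft Q\triangleright R)/H=P/\partial_Q(H)$ and $\partial_{P\triangleleft Q\triangleright R}(H)=\partial_P(\partial_Q(H))$ if $Q/H=T$, and $(P\triangleleft Q\triangleright R)/H=R/\partial_Q(H)$, $\partial_{P\triangleleft Q\triangleright R}(H)=\partial_R(\partial_Q(H))$ if $Q/H=F$. The variety $fr$ is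 the class of all RVAs. $P\equiv_{fr}Q$ means $P/H=Q/H$ for all RVAs and all $H$; $=_{fr}$ is the largest congruence (with respect to conditional composition) on closed terms contained in $\equiv_{fr}$. -}

module Defs where

open import Data.Bool using (Bool; true; false; if_then_else_)
open import Data.Empty using (⊥)
open import Data.Nat using (ℕ)
open import Data.Product using (Σ; _×_)
open import Relation.Binary.PropositionalEquality using (_≡_)

data Term (A : Set) (X : Set) : Set where
  T F : Term A X
  atom : A → Term A X
  var  : X → Term A X
  _◁_▷_ : Term A X → Term A X → Term A X → Term A X

Closed : Set → Set
Closed A = Term A ⊥

OTerm : Set → Set
OTerm A = Term A ℕ

_[_] : {A X Y : Set} → Term A X → (X → Term A Y) → Term A Y
T [ σ ] = T
F [ σ ] = F
atom a [ σ ] = atom a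
var x [ σ ] = σ x
(p ◁ q ▷ r) [ σ ] = (p [ σ ]) ◁ (q [ σ ]) ▷ (r [ σ ])

embed : {A X : Set} → Closed A → Term A X
embed T = T
embed F = F
embed (atom a) = atom a
embed (var ())
embed (p ◁ q ▷ r) = embed p ◁ embed q ▷ embed r

data CP⊢_≐_ {A : Set} : OTerm A → OTerm A → Set where
  cp1 : ∀ x y → CP⊢ (x ◁ T ▷ y) ≐ x
  cp2 : ∀ x y → CP⊢ (x ◁ F ▷ y) ≐ y
  cp3 : ∀ x → CP⊢ (T ◁ x ▷ F) ≐ x
  cp4 : ∀ x y z u v →
        CP⊢ (x ◁ (y ◁ z ▷ u) ▷ v) ≐ ((x ◁ y ▷ v) ◁ z ▷ (x ◁ u ▷ v))
  refl′  : ∀ s → CP⊢ s ≐ s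
  sym′   : ∀ {s t} → CP⊢ s ≐ t → CP⊢ t ≐ s
  trans′ : ∀ {s t u} → CP⊢ s ≐ t → CP⊢ t ≐ u → CP⊢ s ≐ u
  cong′  : ∀ {s s′ t t′ u u′} → CP⊢ s ≐ s′ → CP⊢ t ≐ t′ → CP⊢ u ≐ u′ →
           CP⊢ (s ◁ t ▷ u) ≐ (s′ ◁ t′ ▷ u′)
  subst′ : ∀ {s t} (σ : ℕ → OTerm A) → CP⊢ s ≐ t → CP⊢ (s [ σ ]) ≐ (t [ σ ])

record RVA (A : Set) : Set₁ where
  field
    RV   : Set
    T-RV F-RV : RV
    y    : A → RV → Bool
    ∂    : A → RV → RV
    y-T  : ∀ a → y a T-RV ≡ true
    y-F  : ∀ a → y a F-RV ≡ false
    ∂-T  : ∀ a → ∂ a T-RV ≡ T-RV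
    ∂-F  : ∀ a → ∂ a F-RV ≡ F-RV

module Eval {A : Set} (R : RVA A) where
  open RVA R

  mutual
    _/_ : Closed A → RV → Bool
    T / H = true
    F / H = false
    atom a / H = y a H
    var () / H
    (p ◁ q ▷ r) / H = if q / H then p / ∂[ q ] H else r / ∂[ q ] H

    ∂[_] : Closed A → RV → RV
    ∂[ T ] H = H
    ∂[ F ] H = H
    ∂[ atom a ] H = ∂ a H
    ∂[ var () ] H
    ∂[ p ◁ q ▷ r ] H = if q / H then ∂[ p ] (∂[ q ] H) else ∂[ r ] (∂[ q ] H)

_≡fr_ : {A : Set} → Closed A → Closed A → Set₁
_≡fr_ {A} P Q = (R : RVA A) (H : RVA.RV R) → Eval._/_ R P H ≡ Eval._/_ R Q H

record IsCongruence {A : Set} (_~_ : Closed A → Closed A → Set₁) : Set₁ where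
  field
    c-refl  : ∀ P → P ~ P
    c-sym   : ∀ {P Q} → P ~ Q → Q ~ P
    c-trans : ∀ {P Q R} → P ~ Q → Q ~ R → P ~ R
    c-cong  : ∀ {P P′ Q Q′ R R′} → P ~ P′ → Q ~ Q′ → R ~ R′ →
              (P ◁ Q ▷ R) ~ (P′ ◁ Q′ ▷ R′)

-- =_fr : the largest congruence contained in ≡_fr.  A pair lies in the
-- largest such congruence iff it lies in some congruence contained in ≡_fr.
_=fr_ : {A : Set} → Closed A → Closed A → Set₂
_=fr_ {A} P Q =
  Σ (Closed A → Closed A → Set₁) λ _~_ →
    IsCongruence _~_ × (∀ {P′ Q′} → P′ ~ Q′ → P′ ≡fr Q′) × (P ~ Q)

-- An RVA reacts to a closed term P in a valuation H with the reply P/H and the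
-- successor valuation ∂_P(H).  Equality of this whole reaction in every RVA is a
-- congruence: the reaction of P ◁ Q ▷ R is obtained by running Q and then P or R
-- according to Q's reply.  It is contained in ≡_fr, and every closed instance of
-- CP1–CP4 preserves reactions (case split on the replies of the conditions).
-- Soundness of CP then follows by induction on derivations, with the variables
-- instantiated by closed terms.
module Submission where

open import Defs
open import Data.Nat using (ℕ; suc)
open import Data.Fin using (Fin)
open import Data.Bool using (Bool; true; false; if_then_else_)
open import Data.Product using (_×_; _,_; proj₁)
open import Relation.Binary.PropositionalEquality
  using (_≡_; refl; sym; trans; cong; subst₂; module ≡-Reasoning)

[]-∘ : {A X Y Z : Set} (s : Term A X) (σ : X → Term A Y) (ρ : Y → Term A Z) →
       (s [ σ ]) [ ρ ] ≡ s [ (λ x → σ x [ ρ ]) ]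
[]-∘ T σ ρ = refl
[]-∘ F σ ρ = refl
[]-∘ (atom a) σ ρ = refl
[]-∘ (var x) σ ρ = refl
[]-∘ (p ◁ q ▷ r) σ ρ rewrite []-∘ p σ ρ | []-∘ q σ ρ | []-∘ r σ ρ = refl

embed-[] : {A X : Set} (P : Closed A) (ρ : X → Closed A) → embed P [ ρ ] ≡ P
embed-[] T ρ = refl
embed-[] F ρ = refl
embed-[] (atom a) ρ = refl
embed-[] (var ()) ρ
embed-[] (p ◁ q ▷ r) ρ rewrite embed-[] p ρ | embed-[] q ρ | embed-[] r ρ = refl

module Reaction {A : Set} (R : RVA A) where
  open RVA R using (RV)
  open Eval R

  react : Closed A → RV → Bool × RV
  react P H = P / H , ∂[ P ] H

  branch : Closed A → Closed A → Bool × RV → Bool × RV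
  branch P S (b , H) = (if b then react P else react S) H

  react-◁▷ : (P Q S : Closed A) (H : RV) →
             react (P ◁ Q ▷ S) H ≡ branch P S (react Q H)
  react-◁▷ P Q S H with Q / H
  ... | true  = refl
  ... | false = refl

open Reaction using (react; branch; react-◁▷)

module _ {A : Set} where

  infix 4 _≃_

  record _≃_ (P Q : Closed A) : Set₁ where
    constructor mk≃
    field
      same-react : (R : RVA A) (H : RVA.RV R) → react R P H ≡ react R Q H
  open _≃_

  ≃-cong : ∀ {P P′ Q Q′ S S′} → P ≃ P′ → Q ≃ Q′ → S ≃ S′ →
           (P ◁ Q ▷ S) ≃ (P′ ◁ Q′ ▷ S′)
  ≃-cong {P} {P′} {Q} {Q′} {S} {S′} p q s = mk≃ λ R H → begin
    react R (P ◁ Q ▷ S) H          ≡⟨ react-◁▷ R P Q S H ⟩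
    branch R P S (react R Q H)     ≡⟨ cong (branch R P S) (same-react q R H) ⟩
    branch R P S (react R Q′ H)    ≡⟨ branch-cong R (react R Q′ H) ⟩
    branch R P′ S′ (react R Q′ H)  ≡⟨ sym (react-◁▷ R P′ Q′ S′ H) ⟩
    react R (P′ ◁ Q′ ▷ S′) H       ∎
    where
    open ≡-Reasoning
    branch-cong : (R : RVA A) (r : Bool × RVA.RV R) → branch R P S r ≡ branch R P′ S′ r
    branch-cong R (true  , H) = same-react p R H
    branch-cong R (false , H) = same-react s R H

  ≃-isCongruence : IsCongruence _≃_
  ≃-isCongruence = record
    { c-refl  = λ P → mk≃ λ R H → refl
    ; c-sym   = λ p → mk≃ λ R H → sym (same-react p R H)
    ; c-trans = λ p q → mk≃ λ R H → trans (same-react p R H) (same-react q R H)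
    ; c-cong  = ≃-cong
    }

  ≃⇒≡fr : ∀ {P Q} → P ≃ Q → P ≡fr Q
  ≃⇒≡fr p R H = cong proj₁ (same-react p R H)

  cp3-≃ : (x : Closed A) → (T ◁ x ▷ F) ≃ x
  cp3-≃ x = mk≃ λ R H → go R H
    where
    go : (R : RVA A) (H : RVA.RV R) → react R (T ◁ x ▷ F) H ≡ react R x H
    go R H with Eval._/_ R x H
    ... | true  = refl
    ... | false = refl

  cp4-≃ : (x y z u v : Closed A) →
          (x ◁ (y ◁ z ▷ u) ▷ v) ≃ ((x ◁ y ▷ v) ◁ z ▷ (x ◁ u ▷ v))
  cp4-≃ x y z u v = mk≃ go
    where
    go : (R : RVA A) (H : RVA.RV R) →
         react R (x ◁ (y ◁ z ▷ u) ▷ v) H ≡ react R ((x ◁ y ▷ v) ◁ z ▷ (x ◁ u ▷ v)) H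
    go R H with Eval._/_ R z H
    ... | true  with Eval._/_ R y (Eval.∂[_] R z H)
    ...   | true  = refl
    ...   | false = refl
    go R H | false with Eval._/_ R u (Eval.∂[_] R z H)
    ...   | true  = refl
    ...   | false = refl

  CP-sound : ∀ {s t : OTerm A} → CP⊢ s ≐ t → (ρ : ℕ → Closed A) → s [ ρ ] ≃ t [ ρ ]
  CP-sound (cp1 x y) ρ = mk≃ λ R H → refl
  CP-sound (cp2 x y) ρ = mk≃ λ R H → refl
  CP-sound (cp3 x) ρ = cp3-≃ (x [ ρ ])
  CP-sound (cp4 x y z u v) ρ = cp4-≃ (x [ ρ ]) (y [ ρ ]) (z [ ρ ]) (u [ ρ ]) (v [ ρ ])
  CP-sound (refl′ s) ρ = IsCongruence.c-refl ≃-isCongruence (s [ ρ ])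
  CP-sound (sym′ d) ρ = IsCongruence.c-sym ≃-isCongruence (CP-sound d ρ)
  CP-sound (trans′ d e) ρ = IsCongruence.c-trans ≃-isCongruence (CP-sound d ρ) (CP-sound e ρ)
  CP-sound (cong′ d e f) ρ = ≃-cong (CP-sound d ρ) (CP-sound e ρ) (CP-sound f ρ)
  CP-sound (subst′ {s} {t} σ d) ρ
    rewrite []-∘ s σ ρ | []-∘ t σ ρ = CP-sound d (λ x → σ x [ ρ ])

mainTheorem3 : (n : ℕ) (P Q : Closed (Fin (suc n))) →
    CP⊢ embed P ≐ embed Q → P =fr Q
mainTheorem3 n P Q d =
  _≃_ , ≃-isCongruence , ≃⇒≡fr ,
  subst₂ _≃_ (embed-[] P ρ) (embed-[] Q ρ) (CP-sound d ρ)
  where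
  ρ : ℕ → Closed (Fin (suc n))
  ρ _ = T
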